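{- Any finite subposet of Young's lattice is (isomorphic to) a subposet of the key poset on weak compositions of length $n$ for some $n$.
   Context: Young's lattice is the set of integer partitions $\lambda=(\lambda_1\ge\lambda_2\ge\cdots\ge\lambda_\ell>0)$ ordered by $\lambda\subseteq\mu$ iff $\lambda_i\le\mu_i$ for all $i$ (parts beyond the length being $0$). A weak composition of length $n$ is a sequence $(a_1,\dots,a_n)$ of nonnegative integers; the key poset is the partial order on these given by $\mathbf{a}\preceq\mathbf{b}$ iff $a_i\le b_i$ for all $i$ and, for all $i<j$ with $b_j>a_j$ and $a_i>a_j$, we have $b_i>b_j$. -}

module Defs where

open import Data.Nat using (ℕ; zero; suc; _≤_; _<_; _≥_; _>_)
open import Data.List using (List; []; _∷_)
open import Data.List.Relation.Unary.All using (All)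
open import Data.List.Relation.Unary.Linked using (Linked)
open import Data.Vec using (Vec; lookup)
open import Data.Fin as Fin using (Fin)
open import Data.Product using (_×_)

record Partition : Set where
  constructor mkPartition
  field
    parts      : List ℕ
    decreasing : Linked _≥_ parts
    positive   : All (λ x → 0 < x) parts
open Partition public

partAt : List ℕ → ℕ → ℕ
partAt []       _       = 0
partAt (x ∷ _)  zero    = x
partAt (_ ∷ xs) (suc i) = partAt xs i

_⊆Y_ : Partition → Partition → Set
λ' ⊆Y μ = ∀ i → partAt (parts λ') i ≤ partAt (parts μ) i

_≼K_ : ∀ {n} → Vec ℕ n → Vec ℕ n → Set
_≼K_ {n} a b =
  (∀ (i : Fin n) → lookup a i ≤ lookup b i) ×
  (∀ (i j : Fin n) → i Fin.< j → lookup b j > lookup a j →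
     lookup a i > lookup a j → lookup b i > lookup b j)

module Submission where

open import Defs
open import Data.Nat using (ℕ; zero; suc; _≤_; _≥_; z≤n; s≤s; _<?_)
open import Data.Nat.Properties using (≤-refl; ≤-trans; <⇒≤; <⇒≱; ≮⇒≥; ∸-monoʳ-≤)
open import Data.List using (List; []; _∷_; length; map)
open import Data.List.Extrema.Nat using (max; xs≤max)
open import Data.List.Membership.Propositional using (_∈_)
import Data.List.Relation.Unary.All as All
open import Data.List.Relation.Unary.All.Properties using (map⁻)
open import Data.List.Relation.Unary.Linked using (Linked; []; [-]; _∷_)
open import Data.Vec using (Vec; tabulate; lookup)
open import Data.Vec.Properties using (lookup∘tabulate)
open import Data.Fin as Fin using (Fin; toℕ; opposite; fromℕ<)
open import Data.Fin.Properties using (opposite-prop; opposite-involutive; toℕ-fromℕ<)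
open import Data.Product using (Σ; ∃; _,_; proj₁)
open import Function using (_∘_)
open import Function.Bundles using (_⇔_; mk⇔)
open import Function.Properties.Equivalence using (trans)
open import Relation.Binary.Core using (_Preserves_⟶_)
open import Relation.Binary.PropositionalEquality using (_≡_; refl; subst; subst₂)
open import Relation.Nullary using (yes; no; contradiction)

-- Reading a partition backwards, padded with zeros on the left to length n,
-- gives a weakly increasing composition. Below a weakly increasing a the second
-- clause of the key order is vacuous (a_i > a_j with i < j never happens), so
-- a ≼K b is componentwise ≤, and on reversed partitions of length at most n
-- that is containment of Young diagrams.

partAt-≤-head : ∀ {x xs} → Linked _≥_ (x ∷ xs) → ∀ i → partAt (x ∷ xs) i ≤ x
partAt-≤-head _         zero    = ≤-refl
partAt-≤-head [-]       (suc i) = z≤n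
partAt-≤-head (x≥y ∷ l) (suc i) = ≤-trans (partAt-≤-head l i) x≥y

partAt-antitone : ∀ {xs} → Linked _≥_ xs → partAt xs Preserves _≤_ ⟶ _≥_
partAt-antitone {[]}    _       _                  = z≤n
partAt-antitone {_ ∷ _} l       {zero}  {j} _      = partAt-≤-head l j
partAt-antitone {_ ∷ _} [-]     {suc i} (s≤s i≤j)  = partAt-antitone [] i≤j
partAt-antitone {_ ∷ _} (_ ∷ l) {suc i} (s≤s i≤j)  = partAt-antitone l i≤j

partAt-beyond-length : ∀ xs {i} → length xs ≤ i → partAt xs i ≡ 0
partAt-beyond-length []       _         = refl
partAt-beyond-length (_ ∷ xs) (s≤s len) = partAt-beyond-length xs len

pointwise-≤⇔≼K : ∀ {n} (a b : Vec ℕ n) → lookup a Preserves Fin._<_ ⟶ _≤_ →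
                 (∀ i → lookup a i ≤ lookup b i) ⇔ a ≼K b
pointwise-≤⇔≼K _ _ a-mono = mk⇔ (λ a≤b →
  a≤b , λ _ _ i<j _ aᵢ>aⱼ → contradiction (a-mono i<j) (<⇒≱ aᵢ>aⱼ)) proj₁

reversedParts : ∀ n → Partition → Vec ℕ n
reversedParts n p = tabulate (partAt (parts p) ∘ toℕ ∘ opposite)

lookup-reversedParts : ∀ {n} p (k : Fin n) →
                       lookup (reversedParts n p) k ≡ partAt (parts p) (toℕ (opposite k))
lookup-reversedParts p = lookup∘tabulate (partAt (parts p) ∘ toℕ ∘ opposite)

toℕ-opposite-antitone : ∀ {n} → (λ (i : Fin n) → toℕ (opposite i)) Preserves Fin._<_ ⟶ _≥_
toℕ-opposite-antitone {n} {i} {j} i<j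
  rewrite opposite-prop i | opposite-prop j = ∸-monoʳ-≤ n (s≤s (<⇒≤ i<j))

reversedParts-monotone : ∀ {n} p → lookup (reversedParts n p) Preserves Fin._<_ ⟶ _≤_
reversedParts-monotone p {i} {j} i<j
  rewrite lookup-reversedParts p i | lookup-reversedParts p j =
  partAt-antitone (decreasing p) (toℕ-opposite-antitone i<j)

⊆Y⇔pointwise-reversedParts : ∀ {n} p q → length (parts p) ≤ n →
  p ⊆Y q ⇔ (∀ k → lookup (reversedParts n p) k ≤ lookup (reversedParts n q) k)
⊆Y⇔pointwise-reversedParts {n} p q len≤n = mk⇔ ⊆Y⇒pointwise pointwise⇒⊆Y
  where
  partAt≤ : ℕ → Set
  partAt≤ i = partAt (parts p) i ≤ partAt (parts q) i

  pointwise⇒⊆Y : (∀ k → lookup (reversedParts n p) k ≤ lookup (reversedParts n q) k) → p ⊆Y q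
  pointwise⇒⊆Y p≤q i with i <? n
  ... | no  i≮n rewrite partAt-beyond-length (parts p) (≤-trans len≤n (≮⇒≥ i≮n)) = z≤n
  ... | yes i<n = subst partAt≤ toℕ-opposite-k p≤q[k]
    where
    k : Fin n
    k = opposite (fromℕ< i<n)

    toℕ-opposite-k : toℕ (opposite k) ≡ i
    toℕ-opposite-k rewrite opposite-involutive (fromℕ< i<n) = toℕ-fromℕ< i<n

    p≤q[k] : partAt≤ (toℕ (opposite k))
    p≤q[k] = subst₂ _≤_ (lookup-reversedParts p k) (lookup-reversedParts q k) (p≤q k)

  ⊆Y⇒pointwise : p ⊆Y q → ∀ k → lookup (reversedParts n p) k ≤ lookup (reversedParts n q) k
  ⊆Y⇒pointwise p⊆q k rewrite lookup-reversedParts p k | lookup-reversedParts q k = p⊆q _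

reversedParts-⊆Y⇔≼K : ∀ {n} p q → length (parts p) ≤ n →
                      p ⊆Y q ⇔ reversedParts n p ≼K reversedParts n q
reversedParts-⊆Y⇔≼K {n} p q len≤n =
  trans (⊆Y⇔pointwise-reversedParts p q len≤n)
        (pointwise-≤⇔≼K (reversedParts n p) (reversedParts n q) (reversedParts-monotone p))

corollary2p6 : (S : List Partition) →
    ∃ λ (n : ℕ) → Σ (Partition → Vec ℕ n) λ f →
    ∀ λ' μ → λ' ∈ S → μ ∈ S → (λ' ⊆Y μ ⇔ f λ' ≼K f μ)
corollary2p6 S = n , reversedParts n , λ λ' μ λ'∈S _ →
  reversedParts-⊆Y⇔≼K λ' μ (All.lookup (map⁻ (xs≤max 0 (map (length ∘ parts) S))) λ'∈S)
  where
  n : ℕ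
  n = max 0 (map (length ∘ parts) S)
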